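{- Let $r\geq 3$ and $n$ be integers with $2r\leq n$, let $E=\{1,\dots,n\}$, $X_1=\{1,\dots,r\}$, $X_2=\{r+1,\dots,2r\}$, $X_3=\{r,\dots,2r-1\}$. Let $R_{r,n}$ be the matroid on $E$ whose bases are all $r$-element subsets of $E$ other than $X_1$ and $X_2$, and let $Q_{r,n}$ be the matroid on $E$ whose bases are all $r$-element subsets of $E$ other than $X_1$ and $X_3$. Then $T^{(2)}(R_{r,n})\neq T^{(2)}(Q_{r,n})$.
   Context: For a matroid $M$ on a finite set $E$ with rank function $\rho$ ($\rho(A)$ is the size of a largest independent subset of $A$, $\rho(M)=\rho(E)$), the Tutte polynomial of genus $2$ is the polynomial in eight indeterminates $$T^{(2)}(M)=\sum_{A_1,A_2\subseteq E}\prod_{i=1}^{2}(x_i-1)^{\rho(E)-\rho(A_i)}(y_i-1)^{|A_i|-\rho(A_i)}\cdot(x_{\cap}-1)^{\rho(E)-\rho(A_1\cap A_2)}(y_{\cap}-1)^{|A_1\cap A_2|-\rho(A_1\cap A_2)}(x_{\cup}-1)^{\rho(E)-\rho(A_1\cup A_2)}(y_{\cup}-1)^{|A_1\cup A_2|-\rho(A_1\cup A_2)}.$$ (It is known that the classical Tutte polynomials of $R_{r,n}$ and $Q_{r,n}$ coincide while the matroids are non-isomorphic.) -}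

module Defs where

open import Data.Bool using (Bool; true; false; if_then_else_)
import Data.Bool as Bool
open import Data.Nat as ℕ using (ℕ; zero; suc; _∸_; _≤ᵇ_; _<ᵇ_; _⊔_)
open import Data.Integer as ℤ using (ℤ; +_)
open import Data.Fin using (Fin; toℕ)
open import Data.Fin.Subset using (Subset; inside; outside; _⊆_; _∩_; _∪_; ∣_∣)
open import Data.List using (List; []; _∷_; map; concatMap; foldr; upTo)
open import Data.Vec as Vec using (Vec; []; _∷_; tabulate; zipWith)
open import Data.Vec.Properties using (≡-dec)
open import Data.Fin.Subset.Properties using (_⊆?_)
open import Relation.Nullary using (does; ¬_)
open import Relation.Binary.PropositionalEquality using (_≡_)

-- Subsets of a finite ground set E = Fin n (element i of {1..n} is Fin index i-1)

allSubsets : (n : ℕ) → List (Subset n)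
allSubsets zero    = [] ∷ []
allSubsets (suc n) = concatMap (λ s → (outside ∷ s) ∷ (inside ∷ s) ∷ []) (allSubsets n)

_≟ₛ_ : ∀ {n} (p q : Subset n) → Bool
p ≟ₛ q = does (≡-dec Bool._≟_ p q)

_⊆ᵇ_ : ∀ {n} (p q : Subset n) → Bool
p ⊆ᵇ q = does (p ⊆? q)

anyL : ∀ {A : Set} → (A → Bool) → List A → Bool
anyL f = foldr (λ a b → f a Bool.∨ b) false

maxL : List ℕ → ℕ
maxL = foldr _⊔_ 0

record BasisMatroid (n : ℕ) : Set where
  field
    isBasis : Subset n → Bool

open BasisMatroid public

independent : ∀ {n} → BasisMatroid n → Subset n → Bool
independent {n} M I = anyL (λ B → isBasis M B Bool.∧ (I ⊆ᵇ B)) (allSubsets n)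

rank : ∀ {n} → BasisMatroid n → Subset n → ℕ
rank {n} M A =
  maxL (map (λ I → if independent M I Bool.∧ (I ⊆ᵇ A) then ∣ I ∣ else 0) (allSubsets n))

full : ∀ {n} → Subset n
full {n} = Vec.replicate n inside

rankM : ∀ {n} → BasisMatroid n → ℕ
rankM M = rank M full

-- interval {a+1, …, b} of E, i.e. Fin indices i with a ≤ i < b
interval : (n a b : ℕ) → Subset n
interval n a b = tabulate (λ i → if (a ≤ᵇ toℕ i) Bool.∧ (toℕ i <ᵇ b) then inside else outside)

X₁ X₂ X₃ : (r n : ℕ) → Subset n
X₁ r n = interval n 0 r
X₂ r n = interval n r (r ℕ.+ r)
X₃ r n = interval n (r ∸ 1) (r ℕ.+ r ∸ 1)

twoExcluded : (r n : ℕ) → Subset n → Subset n → BasisMatroid n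
twoExcluded r n X Y = record
  { isBasis = λ B → (ℕ._≡ᵇ_ ∣ B ∣ r) Bool.∧ Bool.not (B ≟ₛ X) Bool.∧ Bool.not (B ≟ₛ Y) }

R[_,_] : (r n : ℕ) → BasisMatroid n
R[ r , n ] = twoExcluded r n (X₁ r n) (X₂ r n)

Q[_,_] : (r n : ℕ) → BasisMatroid n
Q[ r , n ] = twoExcluded r n (X₁ r n) (X₃ r n)

-- Polynomials with integer coefficients in k indeterminates, represented by
-- their coefficient function on exponent vectors (finite support is
-- automatic for the polynomials built below).

Exp : ℕ → Set
Exp k = Vec ℕ k

Poly : ℕ → Set
Poly k = Exp k → ℤ

_≈ₚ_ : ∀ {k} → Poly k → Poly k → Set
p ≈ₚ q = ∀ e → p e ≡ q e

sumℤ : List ℤ → ℤ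
sumℤ = foldr ℤ._+_ (+ 0)

below : ∀ {k} → Exp k → List (Exp k)
below []       = [] ∷ []
below (e ∷ es) = concatMap (λ a → map (a ∷_) (below es)) (upTo (suc e))

isZeroExp : ∀ {k} → Exp k → Bool
isZeroExp []       = true
isZeroExp (zero ∷ es) = isZeroExp es
isZeroExp (suc _ ∷ _) = false

constP : ∀ {k} → ℤ → Poly k
constP c e = if isZeroExp e then c else + 0

0ₚ 1ₚ : ∀ {k} → Poly k
0ₚ = constP (+ 0)
1ₚ = constP (+ 1)

varP : ∀ {k} → Fin k → Poly k
varP j e = if does (≡-dec ℕ._≟_ e (unitExp j)) then + 1 else + 0
  where
  unitExp : ∀ {k} → Fin k → Exp k
  unitExp j = tabulate (λ i → if does (i Data.Fin.≟ j) then 1 else 0)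

infixl 6 _+ₚ_ _-ₚ_
infixl 7 _*ₚ_
infixr 8 _^ₚ_

_+ₚ_ : ∀ {k} → Poly k → Poly k → Poly k
(p +ₚ q) e = p e ℤ.+ q e

_-ₚ_ : ∀ {k} → Poly k → Poly k → Poly k
(p -ₚ q) e = p e ℤ.- q e

_*ₚ_ : ∀ {k} → Poly k → Poly k → Poly k
(p *ₚ q) e = sumℤ (map (λ d → p d ℤ.* q (zipWith _∸_ e d)) (below e))

_^ₚ_ : ∀ {k} → Poly k → ℕ → Poly k
p ^ₚ zero  = 1ₚ
p ^ₚ suc m = p *ₚ (p ^ₚ m)

sumP : ∀ {k} → List (Poly k) → Poly k
sumP = foldr _+ₚ_ 0ₚ

x₁ y₁ x₂ y₂ x∩ y∩ x∪ y∪ : Poly 8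
x₁ = varP (# 0) where open import Data.Fin using (#_)
y₁ = varP (# 1) where open import Data.Fin using (#_)
x₂ = varP (# 2) where open import Data.Fin using (#_)
y₂ = varP (# 3) where open import Data.Fin using (#_)
x∩ = varP (# 4) where open import Data.Fin using (#_)
y∩ = varP (# 5) where open import Data.Fin using (#_)
x∪ = varP (# 6) where open import Data.Fin using (#_)
y∪ = varP (# 7) where open import Data.Fin using (#_)

factor : ∀ {n} → BasisMatroid n → Poly 8 → Poly 8 → Subset n → Poly 8
factor M x y A = ((x -ₚ 1ₚ) ^ₚ (rankM M ∸ rank M A)) *ₚ ((y -ₚ 1ₚ) ^ₚ (∣ A ∣ ∸ rank M A))

tutte2 : ∀ {n} → BasisMatroid n → Poly 8
tutte2 {n} M = sumP (concatMap (λ A₁ → map (λ A₂ →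
      factor M x₁ y₁ A₁ *ₚ factor M x₂ y₂ A₂
   *ₚ factor M x∩ y∩ (A₁ ∩ A₂) *ₚ factor M x∪ y∪ (A₁ ∪ A₂))
   (allSubsets n)) (allSubsets n))

module Submission where

-- Both matroids arise from the uniform matroid U_{r,n} by removing two bases
-- X and Y, which become circuit-hyperplanes; in R they are disjoint (X₁, X₂),
-- in Q they share one element (X₁, X₃).  We compare the coefficients of the
-- monomial x₁y₁x₂y₂y∪ in the two polynomials.
--
--  * Coefficients of products of polynomials in disjoint sets of variables
--    factor.  With the constant and linear coefficients c₀, c₁ of (x - 1)^a
--    this gives the contribution τ(A₁, A₂) of each pair of subsets.
--  * In a matroid whose bases are the r-sets other than X and Y, where
--    |X ∩ Y| = k ≤ r - 2, every set except X and Y has the rank min(|A|, r) it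
--    has in U_{r,n}.  So only the pairs from {X, Y} contribute:
--    τ(X,X) = τ(Y,Y) = -1 and τ(X,Y) = τ(Y,X) = -(r - k).
--  * Hence the coefficient is -2(r - k + 1): -2(r + 1) for R (k = 0) and
--    -2r for Q (k = 1), so the polynomials differ.

open import Defs
open import Data.Nat using (ℕ; _≤_; _+_)
open import Relation.Nullary using (¬_)

open import Data.Bool as B using (Bool; true; false; _∧_; _∨_; if_then_else_)
open import Data.Nat as N using (zero; suc; _∸_; _<_; z≤n; s≤s; _⊓_; _⊔_; _≤ᵇ_; _<ᵇ_)
import Data.Nat.Properties as NP
open import Data.Integer as Z using (ℤ; +_; -[1+_]) renaming (_+_ to _⊕_; _*_ to _⊛_)
import Data.Integer.Properties as ZP
open import Data.Fin as F using (Fin; toℕ; #_)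
import Data.Fin.Properties as FP
open import Data.Fin.Subset as S using (Subset; inside; outside; ∣_∣; _∈_; _∉_; _⊆_; _∩_; _∪_; ⁅_⁆; ∁)
import Data.Fin.Subset.Properties as SP
open import Data.List as L using (List; []; _∷_; concatMap; upTo; applyUpTo)
import Data.List.Properties as LP
open import Data.List.Relation.Unary.Any as Any using (here; there)
import Data.List.Membership.Propositional as ML
import Data.List.Membership.Propositional.Properties as MLP
open import Data.Vec as V using ([]; _∷_; lookup; tabulate; zipWith)
import Data.Vec.Properties as VP
open import Data.Product using (Σ; _×_; _,_; proj₁; proj₂)
open import Data.Sum using (_⊎_; inj₁; inj₂; [_,_])
open import Data.Empty using (⊥; ⊥-elim)
open import Data.Unit using (tt)
open import Relation.Nullary using (Dec; yes; no; does)
import Relation.Nullary.Decidable as Dec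
import Data.Bool.Properties as BP
open import Relation.Binary.Definitions using (DecidableEquality; tri<; tri≈; tri>)
open import Relation.Binary.PropositionalEquality hiding ([_])
open import Function using (_∘_; id)
open import Function.Bundles using (Equivalence)
import Data.Integer.Solver
import Algebra.Properties.CommutativeSemigroup ZP.+-commutativeSemigroup as ℤ+

sum-++ : (xs ys : List ℤ) → sumℤ (xs L.++ ys) ≡ sumℤ xs ⊕ sumℤ ys
sum-++ []       ys = sym (ZP.+-identityˡ _)
sum-++ (x ∷ xs) ys = trans (cong (x ⊕_) (sum-++ xs ys)) (sym (ZP.+-assoc x _ _))

sum-concatMap : ∀ {A C : Set} (g : C → ℤ) (h : A → List C) (xs : List A) →
  sumℤ (L.map g (concatMap h xs)) ≡ sumℤ (L.map (λ a → sumℤ (L.map g (h a))) xs)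
sum-concatMap g h []       = refl
sum-concatMap g h (x ∷ xs) = begin
    sumℤ (L.map g (h x L.++ concatMap h xs))
  ≡⟨ cong sumℤ (LP.map-++ g (h x) (concatMap h xs)) ⟩
    sumℤ (L.map g (h x) L.++ L.map g (concatMap h xs))
  ≡⟨ sum-++ (L.map g (h x)) _ ⟩
    sumℤ (L.map g (h x)) ⊕ sumℤ (L.map g (concatMap h xs))
  ≡⟨ cong (sumℤ (L.map g (h x)) ⊕_) (sum-concatMap g h xs) ⟩
    sumℤ (L.map (λ a → sumℤ (L.map g (h a))) (x ∷ xs)) ∎
  where open ≡-Reasoning

sum-zero : ∀ {A : Set} (g : A → ℤ) (xs : List A) → (∀ a → g a ≡ + 0) →
  sumℤ (L.map g xs) ≡ + 0
sum-zero g []       g≡0 = refl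
sum-zero g (x ∷ xs) g≡0 rewrite g≡0 x | sum-zero g xs g≡0 = refl

sum-+ : ∀ {A : Set} (g h : A → ℤ) (xs : List A) →
  sumℤ (L.map (λ a → g a ⊕ h a) xs) ≡ sumℤ (L.map g xs) ⊕ sumℤ (L.map h xs)
sum-+ g h []       = refl
sum-+ g h (x ∷ xs) rewrite sum-+ g h xs = ℤ+.interchange (g x) (h x) _ _

-- `xs` counts every point once: a function supported at one point sums to its
-- value there.  (`allSubsets n` is such a list.)
CountsOnce : ∀ {A : Set} → List A → Set
CountsOnce {A} xs = ∀ (g : A → ℤ) c → (∀ a → ¬ a ≡ c → g a ≡ + 0) → sumℤ (L.map g xs) ≡ g c

countsOnce-two : ∀ {A : Set} → DecidableEquality A → (xs : List A) → CountsOnce xs →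
  ∀ (g : A → ℤ) s t → ¬ s ≡ t → (∀ a → ¬ a ≡ s → ¬ a ≡ t → g a ≡ + 0) →
  sumℤ (L.map g xs) ≡ g s ⊕ g t
countsOnce-two _≟_ xs once g s t s≢t g≡0 = begin
    sumℤ (L.map g xs)                           ≡⟨ cong sumℤ (LP.map-cong split xs) ⟩
    sumℤ (L.map (λ a → atS a ⊕ offS a) xs)      ≡⟨ sum-+ atS offS xs ⟩
    sumℤ (L.map atS xs) ⊕ sumℤ (L.map offS xs)  ≡⟨ cong₂ _⊕_ (once atS s atS≡0) (once offS t offS≡0) ⟩
    atS s ⊕ offS t                              ≡⟨ cong₂ _⊕_ atS-s offS-t ⟩
    g s ⊕ g t                                   ∎
  where
  open ≡-Reasoning
  atS offS : _ → ℤ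
  atS a with a ≟ s
  ... | yes _ = g a
  ... | no  _ = + 0
  offS a with a ≟ s
  ... | yes _ = + 0
  ... | no  _ = g a
  split : ∀ a → g a ≡ atS a ⊕ offS a
  split a with a ≟ s
  ... | yes _ = sym (ZP.+-identityʳ _)
  ... | no  _ = sym (ZP.+-identityˡ _)
  atS≡0 : ∀ a → ¬ a ≡ s → atS a ≡ + 0
  atS≡0 a a≢s with a ≟ s
  ... | yes a≡s = ⊥-elim (a≢s a≡s)
  ... | no  _   = refl
  offS≡0 : ∀ a → ¬ a ≡ t → offS a ≡ + 0
  offS≡0 a a≢t with a ≟ s
  ... | yes _   = refl
  ... | no  a≢s = g≡0 a a≢s a≢t
  atS-s : atS s ≡ g s
  atS-s with s ≟ s
  ... | yes _   = refl
  ... | no  s≢s = ⊥-elim (s≢s refl)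
  offS-t : offS t ≡ g t
  offS-t with t ≟ s
  ... | yes t≡s = ⊥-elim (s≢t (sym t≡s))
  ... | no  _   = refl

sum-applyUpTo-zero : (h : ℕ → ℤ) (f : ℕ → ℕ) (n : ℕ) → (∀ i → i < n → h (f i) ≡ + 0) →
  sumℤ (L.map h (applyUpTo f n)) ≡ + 0
sum-applyUpTo-zero h f zero    h≡0 = refl
sum-applyUpTo-zero h f (suc n) h≡0
  rewrite h≡0 0 (s≤s z≤n) | sum-applyUpTo-zero h (f ∘ suc) n (λ i i<n → h≡0 (suc i) (s≤s i<n)) = refl

sum-applyUpTo-single : (h : ℕ → ℤ) (f : ℕ → ℕ) (n c : ℕ) → c < n →
  (∀ i → i < n → ¬ i ≡ c → h (f i) ≡ + 0) → sumℤ (L.map h (applyUpTo f n)) ≡ h (f c)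
sum-applyUpTo-single h f (suc n) zero    _         h≡0
  rewrite sum-applyUpTo-zero h (f ∘ suc) n (λ i i<n → h≡0 (suc i) (s≤s i<n) λ ()) = ZP.+-identityʳ _
sum-applyUpTo-single h f (suc n) (suc c) (s≤s c<n) h≡0
  rewrite h≡0 0 (s≤s z≤n) (λ ()) = trans (ZP.+-identityˡ _)
    (sum-applyUpTo-single h (f ∘ suc) n c c<n
      (λ i i<n i≢c → h≡0 (suc i) (s≤s i<n) (i≢c ∘ NP.suc-injective)))

allSubsets-countsOnce : ∀ n → CountsOnce (allSubsets n)
allSubsets-countsOnce zero    g []      g≡0 = ZP.+-identityʳ _
allSubsets-countsOnce (suc n) g (b ∷ s) g≡0 =
  trans (sum-concatMap g (λ s → (outside ∷ s) ∷ (inside ∷ s) ∷ []) (allSubsets n))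
        (trans (allSubsets-countsOnce n both s both≡0) (head b g≡0))
  where
  both : Subset n → ℤ
  both s' = g (outside ∷ s') ⊕ (g (inside ∷ s') ⊕ + 0)
  both≡0 : ∀ s' → ¬ s' ≡ s → both s' ≡ + 0
  both≡0 s' s'≢s rewrite g≡0 (outside ∷ s') (s'≢s ∘ cong V.tail)
                       | g≡0 (inside ∷ s') (s'≢s ∘ cong V.tail) = refl
  head : ∀ b → (∀ a → ¬ a ≡ b ∷ s → g a ≡ + 0) → both s ≡ g (b ∷ s)
  head false g≡0 rewrite g≡0 (inside ∷ s) (λ ()) = ZP.+-identityʳ _
  head true  g≡0 rewrite g≡0 (outside ∷ s) (λ ()) = trans (ZP.+-identityˡ _) (ZP.+-identityʳ _)

-- Coefficients of products of polynomials

_≤ₑ_ : ∀ {k} → Exp k → Exp k → Set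
d ≤ₑ e = ∀ j → lookup d j ≤ lookup e j

sum-below-split : ∀ {k} (g : Exp (suc k) → ℤ) (e : ℕ) (es : Exp k) →
  sumℤ (L.map g (below (e ∷ es)))
    ≡ sumℤ (L.map (λ a → sumℤ (L.map (λ d → g (a ∷ d)) (below es))) (upTo (suc e)))
sum-below-split g e es = trans (sum-concatMap g (λ a → L.map (a ∷_) (below es)) (upTo (suc e)))
  (cong sumℤ (LP.map-cong (λ a → cong sumℤ (sym (LP.map-∘ (below es)))) (upTo (suc e))))

sum-below-zero : ∀ {k} (e : Exp k) (g : Exp k → ℤ) → (∀ d → d ≤ₑ e → g d ≡ + 0) →
  sumℤ (L.map g (below e)) ≡ + 0
sum-below-zero []       g g≡0 rewrite g≡0 [] (λ ()) = refl
sum-below-zero (e ∷ es) g g≡0 = trans (sum-below-split g e es)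
  (sum-applyUpTo-zero _ id (suc e) λ i i≤e → sum-below-zero es (λ d → g (i ∷ d))
     λ d d≤es → g≡0 (i ∷ d) λ { F.zero → NP.≤-pred i≤e ; (F.suc j) → d≤es j })

sum-below-single : ∀ {k} (e c : Exp k) (g : Exp k → ℤ) → c ≤ₑ e →
  (∀ d → d ≤ₑ e → ¬ d ≡ c → g d ≡ + 0) → sumℤ (L.map g (below e)) ≡ g c
sum-below-single []       []       g c≤e g≡0 = ZP.+-identityʳ _
sum-below-single (e ∷ es) (c ∷ cs) g c≤e g≡0 = trans (sum-below-split g e es)
  (trans (sum-applyUpTo-single _ id (suc e) c (s≤s (c≤e F.zero))
            λ i i≤e i≢c → sum-below-zero es (λ d → g (i ∷ d))
              λ d d≤es → g≡0 (i ∷ d) (λ { F.zero → NP.≤-pred i≤e ; (F.suc j) → d≤es j })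
                                     (i≢c ∘ cong V.head))
         (sum-below-single es cs (λ d → g (c ∷ d)) (c≤e ∘ F.suc)
            λ d d≤es d≢cs → g≡0 (c ∷ d) (λ { F.zero → c≤e F.zero ; (F.suc j) → d≤es j })
                                        (d≢cs ∘ cong V.tail)))

UsesOutside : ∀ {k} → (Fin k → Bool) → Exp k → Set
UsesOutside {k} S d = Σ (Fin k) λ j → S j ≡ false × ¬ lookup d j ≡ 0

SupportedIn : ∀ {k} → (Fin k → Bool) → Poly k → Set
SupportedIn S p = ∀ d → UsesOutside S d → p d ≡ + 0

∨-≡false : ∀ {a b} → a ∨ b ≡ false → a ≡ false × b ≡ false
∨-≡false {false} {false} _ = refl , refl
∨-≡false {false} {true}  ()
∨-≡false {true}          ()

supported-* : ∀ {k} {S T : Fin k → Bool} {p q : Poly k} → SupportedIn S p → SupportedIn T q →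
  SupportedIn (λ j → S j ∨ T j) (p *ₚ q)
supported-* {S = S} {T} {p} {q} p⊆S q⊆T d (j , S∨T≡false , d≢0) =
  sum-below-zero d (λ d' → p d' ⊛ q (zipWith _∸_ d d')) λ d' _ → term d'
  where
  term : ∀ d' → p d' ⊛ q (zipWith _∸_ d d') ≡ + 0
  term d' with lookup d' j N.≟ 0
  ... | no d'≢0 rewrite p⊆S d' (j , proj₁ (∨-≡false S∨T≡false) , d'≢0) = refl
  ... | yes d'≡0 rewrite q⊆T (zipWith _∸_ d d') (j , proj₂ (∨-≡false S∨T≡false) , λ e →
          d≢0 (trans (sym (trans (VP.lookup-zipWith _∸_ j d d') (cong (lookup d j ∸_) d'≡0))) e))
        = ZP.*-zeroʳ (p d')

exp-differ : ∀ {k} (u v : Exp k) → ¬ u ≡ v → Σ (Fin k) λ j → ¬ lookup u j ≡ lookup v j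
exp-differ {k} u v u≢v = FP.¬∀⟶∃¬ k (λ j → lookup u j ≡ lookup v j) (λ j → lookup u j N.≟ lookup v j)
  λ u≗v → u≢v (trans (sym (VP.tabulate∘lookup u)) (trans (VP.tabulate-cong u≗v) (VP.tabulate∘lookup v)))

-- Coordinatewise condition for splitting the exponent `e` as `e₁ + (e - e₁)`, where
-- `e₁` is the part of `e` on the variables of `S` and `T` is disjoint from `S`.
SplitAt : Bool → Bool → ℕ → ℕ → Set
SplitAt true  t e e₁ = t ≡ false × e ≡ e₁
SplitAt false t e e₁ = e₁ ≡ 0

splitAt? : ∀ s t e e₁ → Dec (SplitAt s t e e₁)
splitAt? true  true  e e₁ = no (λ ())
splitAt? true  false e e₁ = Dec.map′ (refl ,_) proj₂ (e N.≟ e₁)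
splitAt? false t     e e₁ = e₁ N.≟ 0

Splits : ∀ {k} → (S T : Fin k → Bool) → Exp k → Exp k → Set
Splits S T e e₁ = ∀ j → SplitAt (S j) (T j) (lookup e j) (lookup e₁ j)

splits? : ∀ {k} (S T : Fin k → Bool) (e e₁ : Exp k) → Dec (Splits S T e e₁)
splits? S T e e₁ = FP.all? λ j → splitAt? (S j) (T j) (lookup e j) (lookup e₁ j)

-- Coefficients of a product of polynomials in disjoint sets of variables factor:
-- the only term of the convolution that survives is the one at `e₁`.
coeff-*-split : ∀ {k} {S T : Fin k → Bool} {p q : Poly k} → SupportedIn S p → SupportedIn T q →
  (e e₁ : Exp k) → Splits S T e e₁ → (p *ₚ q) e ≡ p e₁ ⊛ q (zipWith _∸_ e e₁)
coeff-*-split {S = S} {T} {p} {q} p⊆S q⊆T e e₁ split =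
  sum-below-single e e₁ (λ d → p d ⊛ q (zipWith _∸_ e d)) e₁≤e term
  where
  e₁≤e : e₁ ≤ₑ e
  e₁≤e j with S j | split j
  ... | true  | _ , e≡e₁ = NP.≤-reflexive (sym e≡e₁)
  ... | false | e₁≡0     = subst (_≤ lookup e j) (sym e₁≡0) z≤n
  term : ∀ d → d ≤ₑ e → ¬ d ≡ e₁ → p d ⊛ q (zipWith _∸_ e d) ≡ + 0
  term d d≤e d≢e₁ with exp-differ d e₁ d≢e₁
  ... | j , dj≢e₁j with S j in Sj | split j
  ... | true  | Tj≡false , e≡e₁ rewrite q⊆T (zipWith _∸_ e d) (j , Tj≡false , λ e-d≡0 →
          dj≢e₁j (trans (NP.≤-antisym (d≤e j) (NP.m∸n≡0⇒m≤n
            (trans (sym (VP.lookup-zipWith _∸_ j e d)) e-d≡0))) e≡e₁)) = ZP.*-zeroʳ (p d)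
  ... | false | e₁≡0 rewrite p⊆S d (j , Sj , λ dj≡0 → dj≢e₁j (trans dj≡0 (sym e₁≡0))) = refl

0ₑ : Exp 8
0ₑ = V.replicate 8 0

only : Fin 8 → Fin 8 → Bool
only i j = does (j F.≟ i)

unit : Fin 8 → Exp 8
unit i = tabulate (λ j → if only i j then 1 else 0)

shifted : Fin 8 → Poly 8
shifted i = varP i -ₚ 1ₚ

supported-1 : ∀ {k} (S : Fin k → Bool) → SupportedIn S 1ₚ
supported-1 S d (j , _ , dj≢0) with isZeroExp d in d≡0
... | true  = ⊥-elim (dj≢0 (isZero-lookup d d≡0 j))
  where
  isZero-lookup : ∀ {k} (d : Exp k) → isZeroExp d ≡ true → ∀ j → lookup d j ≡ 0
  isZero-lookup (zero ∷ d) d≡0 F.zero    = refl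
  isZero-lookup (zero ∷ d) d≡0 (F.suc j) = isZero-lookup d d≡0 j
... | false = refl

supported-var : ∀ i → SupportedIn (only i) (varP i)
supported-var i d (j , j∉i , dj≢0) with VP.≡-dec N._≟_ d (unit i)
... | no  _    = refl
... | yes refl = ⊥-elim (dj≢0 (trans (VP.lookup∘tabulate (λ j → if only i j then 1 else 0) j)
                                      (cong (λ b → if b then 1 else 0) j∉i)))

supported-pow : ∀ i a → SupportedIn (only i) (shifted i ^ₚ a)
supported-pow i zero    = supported-1 (only i)
supported-pow i (suc a) d (j , j∉i , dj≢0) =
  supported-* shifted⊆i (supported-pow i a) d (j , cong (λ b → b ∨ b) j∉i , dj≢0)
  where
  shifted⊆i : SupportedIn (only i) (shifted i)
  shifted⊆i d out rewrite supported-var i d out | supported-1 (only i) d out = refl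

module ZS = Data.Integer.Solver.+-*-Solver

-- Constant and linear coefficient of (x - 1)^a, i.e. (-1)^a and a·(-1)^(a-1),
-- given by the recurrences coming from (x - 1)^(a+1) = (x - 1)·(x - 1)^a.
c₀ c₁ : ℕ → ℤ
c₀ zero    = + 1
c₀ (suc a) = -[1+ 0 ] ⊛ c₀ a
c₁ zero    = + 0
c₁ (suc a) = -[1+ 0 ] ⊛ c₁ a ⊕ + 1 ⊛ c₀ a

c₀-squared : ∀ a → c₀ a ⊛ c₀ a ≡ + 1
c₀-squared zero    = refl
c₀-squared (suc a) = trans
  (ZS.solve 1 (λ x → (ZS.con -[1+ 0 ] ZS.:* x) ZS.:* (ZS.con -[1+ 0 ] ZS.:* x) ZS.:= x ZS.:* x) refl (c₀ a))
  (c₀-squared a)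

c₀*c₁ : ∀ a → c₀ a ⊛ c₁ a ≡ Z.- (+ a)
c₀*c₁ zero    = refl
c₀*c₁ (suc a) = begin
  (-[1+ 0 ] ⊛ c₀ a) ⊛ (-[1+ 0 ] ⊛ c₁ a ⊕ + 1 ⊛ c₀ a)
    ≡⟨ ZS.solve 2 (λ x y → (ZS.con -[1+ 0 ] ZS.:* x) ZS.:* (ZS.con -[1+ 0 ] ZS.:* y ZS.:+ ZS.con (+ 1) ZS.:* x)
                             ZS.:= x ZS.:* y ZS.:+ ZS.:- (x ZS.:* x)) refl (c₀ a) (c₁ a) ⟩
  c₀ a ⊛ c₁ a ⊕ Z.- (c₀ a ⊛ c₀ a)
    ≡⟨ cong₂ (λ u v → u ⊕ Z.- v) (c₀*c₁ a) (c₀-squared a) ⟩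
  Z.- (+ a) ⊕ Z.- (+ 1)
    ≡⟨ sym (ZP.neg-distrib-+ (+ a) (+ 1)) ⟩
  Z.- (+ a ⊕ + 1)
    ≡⟨ cong (λ t → Z.- (+ t)) (NP.+-comm a 1) ⟩
  Z.- (+ suc a) ∎
  where open ≡-Reasoning

shifted-at-0 : ∀ i → shifted i 0ₑ ≡ -[1+ 0 ]
shifted-at-0 = Dec.toWitness {a? = FP.all? λ i → shifted i 0ₑ Z.≟ -[1+ 0 ]} tt

shifted-at-unit : ∀ i → shifted i (unit i) ≡ + 1
shifted-at-unit = Dec.toWitness {a? = FP.all? λ i → shifted i (unit i) Z.≟ + 1} tt

one-at-unit : ∀ i → 1ₚ (unit i) ≡ + 0
one-at-unit = Dec.toWitness {a? = FP.all? λ i → 1ₚ {8} (unit i) Z.≟ + 0} tt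

below-unit : ∀ i → below (unit i) ≡ 0ₑ ∷ unit i ∷ []
below-unit = Dec.toWitness
  {a? = FP.all? λ i → LP.≡-dec (VP.≡-dec N._≟_) (below (unit i)) (0ₑ ∷ unit i ∷ [])} tt

unit-∸ : ∀ i → zipWith _∸_ (unit i) 0ₑ ≡ unit i × zipWith _∸_ (unit i) (unit i) ≡ 0ₑ
unit-∸ = Dec.toWitness {a? = FP.all? λ i →
  VP.≡-dec N._≟_ (zipWith _∸_ (unit i) 0ₑ) (unit i)
    Dec.×-dec VP.≡-dec N._≟_ (zipWith _∸_ (unit i) (unit i)) 0ₑ} tt

linear-* : ∀ i (p q : Poly 8) → (p *ₚ q) (unit i) ≡ p 0ₑ ⊛ q (unit i) ⊕ p (unit i) ⊛ q 0ₑ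
linear-* i p q = begin
  sumℤ (L.map term (below (unit i)))            ≡⟨ cong (sumℤ ∘ L.map term) (below-unit i) ⟩
  term 0ₑ ⊕ (term (unit i) ⊕ + 0)               ≡⟨ cong (term 0ₑ ⊕_) (ZP.+-identityʳ _) ⟩
  term 0ₑ ⊕ term (unit i)                       ≡⟨ cong₂ (λ u v → p 0ₑ ⊛ q u ⊕ p (unit i) ⊛ q v) ∸0 ∸unit ⟩
  p 0ₑ ⊛ q (unit i) ⊕ p (unit i) ⊛ q 0ₑ         ∎
  where
  open ≡-Reasoning
  term : Exp 8 → ℤ
  term d = p d ⊛ q (zipWith _∸_ (unit i) d)
  ∸0 = proj₁ (unit-∸ i)
  ∸unit = proj₂ (unit-∸ i)

pow-at-0 : ∀ i a → (shifted i ^ₚ a) 0ₑ ≡ c₀ a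
pow-at-0 i zero    = refl
pow-at-0 i (suc a) = trans (ZP.+-identityʳ _) (cong₂ _⊛_ (shifted-at-0 i) (pow-at-0 i a))

pow-at-unit : ∀ i a → (shifted i ^ₚ a) (unit i) ≡ c₁ a
pow-at-unit i zero    = one-at-unit i
pow-at-unit i (suc a) = begin
  (shifted i *ₚ shifted i ^ₚ a) (unit i)
    ≡⟨ linear-* i (shifted i) (shifted i ^ₚ a) ⟩
  shifted i 0ₑ ⊛ (shifted i ^ₚ a) (unit i) ⊕ shifted i (unit i) ⊛ (shifted i ^ₚ a) 0ₑ
    ≡⟨ cong₂ _⊕_ (cong₂ _⊛_ (shifted-at-0 i) (pow-at-unit i a))
                 (cong₂ _⊛_ (shifted-at-unit i) (pow-at-0 i a)) ⟩
  c₁ (suc a) ∎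
  where open ≡-Reasoning

coeff-*-split! : ∀ {k} {S T : Fin k → Bool} {p q : Poly k} → SupportedIn S p → SupportedIn T q →
  (e e₁ : Exp k) → {_ : Dec.True (splits? S T e e₁)} → (p *ₚ q) e ≡ p e₁ ⊛ q (zipWith _∸_ e e₁)
coeff-*-split! p⊆S q⊆T e e₁ {ok} = coeff-*-split p⊆S q⊆T e e₁ (Dec.toWitness ok)

pairPoly : Fin 8 → Fin 8 → ℕ → ℕ → Poly 8
pairPoly i j a b = (shifted i ^ₚ a) *ₚ (shifted j ^ₚ b)

VarPair : Fin 8 → Fin 8 → Fin 8 → Bool
VarPair i j k = only i k ∨ only j k

supported-pair : ∀ i j a b → SupportedIn (VarPair i j) (pairPoly i j a b)
supported-pair i j a b = supported-* (supported-pow i a) (supported-pow j b)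

x₁y₁ₑ x₂y₂ₑ y∪ₑ x₁y₁x₂y₂ₑ target : Exp 8
x₁y₁ₑ     = 1 ∷ 1 ∷ 0 ∷ 0 ∷ 0 ∷ 0 ∷ 0 ∷ 0 ∷ []
x₂y₂ₑ     = 0 ∷ 0 ∷ 1 ∷ 1 ∷ 0 ∷ 0 ∷ 0 ∷ 0 ∷ []
y∪ₑ       = 0 ∷ 0 ∷ 0 ∷ 0 ∷ 0 ∷ 0 ∷ 0 ∷ 1 ∷ []
x₁y₁x₂y₂ₑ = 1 ∷ 1 ∷ 1 ∷ 1 ∷ 0 ∷ 0 ∷ 0 ∷ 0 ∷ []
target    = 1 ∷ 1 ∷ 1 ∷ 1 ∷ 0 ∷ 0 ∷ 0 ∷ 1 ∷ []

pair₁-at-x₁y₁ : ∀ a b → pairPoly (# 0) (# 1) a b x₁y₁ₑ ≡ c₁ a ⊛ c₁ b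
pair₁-at-x₁y₁ a b = trans (coeff-*-split! (supported-pow (# 0) a) (supported-pow (# 1) b) x₁y₁ₑ (unit (# 0)))
  (cong₂ _⊛_ (pow-at-unit (# 0) a) (pow-at-unit (# 1) b))

pair₂-at-x₂y₂ : ∀ a b → pairPoly (# 2) (# 3) a b x₂y₂ₑ ≡ c₁ a ⊛ c₁ b
pair₂-at-x₂y₂ a b = trans (coeff-*-split! (supported-pow (# 2) a) (supported-pow (# 3) b) x₂y₂ₑ (unit (# 2)))
  (cong₂ _⊛_ (pow-at-unit (# 2) a) (pow-at-unit (# 3) b))

pair∩-at-1 : ∀ a b → pairPoly (# 4) (# 5) a b 0ₑ ≡ c₀ a ⊛ c₀ b
pair∩-at-1 a b = trans (coeff-*-split! (supported-pow (# 4) a) (supported-pow (# 5) b) 0ₑ 0ₑ)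
  (cong₂ _⊛_ (pow-at-0 (# 4) a) (pow-at-0 (# 5) b))

pair∪-at-y∪ : ∀ a b → pairPoly (# 6) (# 7) a b y∪ₑ ≡ c₀ a ⊛ c₁ b
pair∪-at-y∪ a b = trans (coeff-*-split! (supported-pow (# 6) a) (supported-pow (# 7) b) y∪ₑ 0ₑ)
  (cong₂ _⊛_ (pow-at-0 (# 6) a) (pow-at-unit (# 7) b))

coeff-fourPairs : ∀ (P₁ P₂ P₃ P₄ : Poly 8) →
  SupportedIn (VarPair (# 0) (# 1)) P₁ → SupportedIn (VarPair (# 2) (# 3)) P₂ →
  SupportedIn (VarPair (# 4) (# 5)) P₃ → SupportedIn (VarPair (# 6) (# 7)) P₄ →
  (P₁ *ₚ P₂ *ₚ P₃ *ₚ P₄) target ≡ P₁ x₁y₁ₑ ⊛ P₂ x₂y₂ₑ ⊛ P₃ 0ₑ ⊛ P₄ y∪ₑ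
coeff-fourPairs P₁ P₂ P₃ P₄ S₁ S₂ S₃ S₄ = begin
  (P₁ *ₚ P₂ *ₚ P₃ *ₚ P₄) target
    ≡⟨ coeff-*-split! (supported-* (supported-* S₁ S₂) S₃) S₄ target x₁y₁x₂y₂ₑ ⟩
  (P₁ *ₚ P₂ *ₚ P₃) x₁y₁x₂y₂ₑ ⊛ P₄ y∪ₑ
    ≡⟨ cong (_⊛ P₄ y∪ₑ) (coeff-*-split! (supported-* S₁ S₂) S₃ x₁y₁x₂y₂ₑ x₁y₁x₂y₂ₑ) ⟩
  (P₁ *ₚ P₂) x₁y₁x₂y₂ₑ ⊛ P₃ 0ₑ ⊛ P₄ y∪ₑ
    ≡⟨ cong (λ t → t ⊛ P₃ 0ₑ ⊛ P₄ y∪ₑ) (coeff-*-split! S₁ S₂ x₁y₁x₂y₂ₑ x₁y₁ₑ) ⟩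
  P₁ x₁y₁ₑ ⊛ P₂ x₂y₂ₑ ⊛ P₃ 0ₑ ⊛ P₄ y∪ₑ ∎
  where open ≡-Reasoning

⊛-cong₄ : ∀ {a a' b b' c c' d d'} → a ≡ a' → b ≡ b' → c ≡ c' → d ≡ d' →
  a ⊛ b ⊛ c ⊛ d ≡ a' ⊛ b' ⊛ c' ⊛ d'
⊛-cong₄ refl refl refl refl = refl

-- The coefficient of x₁y₁x₂y₂y∪ in a product of four pair polynomials.  (The
-- factors are passed explicitly: inferring them by unification would force Agda
-- to expand the product at `target`.)
fourPairs-at-target : ∀ a₁ b₁ a₂ b₂ a₃ b₃ a₄ b₄ →
  (pairPoly (# 0) (# 1) a₁ b₁ *ₚ pairPoly (# 2) (# 3) a₂ b₂
     *ₚ pairPoly (# 4) (# 5) a₃ b₃ *ₚ pairPoly (# 6) (# 7) a₄ b₄) target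
    ≡ (c₁ a₁ ⊛ c₁ b₁) ⊛ (c₁ a₂ ⊛ c₁ b₂) ⊛ (c₀ a₃ ⊛ c₀ b₃) ⊛ (c₀ a₄ ⊛ c₁ b₄)
fourPairs-at-target a₁ b₁ a₂ b₂ a₃ b₃ a₄ b₄ =
  trans (coeff-fourPairs (pairPoly (# 0) (# 1) a₁ b₁) (pairPoly (# 2) (# 3) a₂ b₂)
                         (pairPoly (# 4) (# 5) a₃ b₃) (pairPoly (# 6) (# 7) a₄ b₄)
                         (supported-pair (# 0) (# 1) a₁ b₁) (supported-pair (# 2) (# 3) a₂ b₂)
                         (supported-pair (# 4) (# 5) a₃ b₃) (supported-pair (# 6) (# 7) a₄ b₄))
        (⊛-cong₄ (pair₁-at-x₁y₁ a₁ b₁) (pair₂-at-x₂y₂ a₂ b₂)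
                 (pair∩-at-1 a₃ b₃) (pair∪-at-y∪ a₄ b₄))

module _ {n : ℕ} (M : BasisMatroid n) where

  corank nullity : Subset n → ℕ
  corank  A = rankM M ∸ rank M A
  nullity A = ∣ A ∣ ∸ rank M A

  at-xy at-1 at-y : Subset n → ℤ
  at-xy A = c₁ (corank A) ⊛ c₁ (nullity A)
  at-1  A = c₀ (corank A) ⊛ c₀ (nullity A)
  at-y  A = c₀ (corank A) ⊛ c₁ (nullity A)

  -- The contribution of the pair (A₁, A₂) to the coefficient of x₁y₁x₂y₂y∪.
  τ : Subset n → Subset n → ℤ
  τ A₁ A₂ = at-xy A₁ ⊛ at-xy A₂ ⊛ at-1 (A₁ ∩ A₂) ⊛ at-y (A₁ ∪ A₂)

  τ-sym : ∀ A₁ A₂ → τ A₁ A₂ ≡ τ A₂ A₁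
  τ-sym A₁ A₂ rewrite SP.∩-comm A₁ A₂ | SP.∪-comm A₁ A₂ =
    cong (λ t → t ⊛ at-1 (A₂ ∩ A₁) ⊛ at-y (A₂ ∪ A₁)) (ZP.*-comm (at-xy A₁) (at-xy A₂))

  summand : Subset n → Subset n → Poly 8
  summand A₁ A₂ = factor M x₁ y₁ A₁ *ₚ factor M x₂ y₂ A₂
               *ₚ factor M x∩ y∩ (A₁ ∩ A₂) *ₚ factor M x∪ y∪ (A₁ ∪ A₂)

  summand-pairs : ∀ A₁ A₂ → summand A₁ A₂ ≡
    pairPoly (# 0) (# 1) (corank A₁) (nullity A₁) *ₚ pairPoly (# 2) (# 3) (corank A₂) (nullity A₂)
      *ₚ pairPoly (# 4) (# 5) (corank (A₁ ∩ A₂)) (nullity (A₁ ∩ A₂))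
      *ₚ pairPoly (# 6) (# 7) (corank (A₁ ∪ A₂)) (nullity (A₁ ∪ A₂))
  summand-pairs A₁ A₂ = refl

  summand-at-target : ∀ A₁ A₂ → summand A₁ A₂ target ≡ τ A₁ A₂
  summand-at-target A₁ A₂ = trans (cong-app (summand-pairs A₁ A₂) target)
    (fourPairs-at-target (corank A₁) (nullity A₁) (corank A₂) (nullity A₂)
      (corank (A₁ ∩ A₂)) (nullity (A₁ ∩ A₂)) (corank (A₁ ∪ A₂)) (nullity (A₁ ∪ A₂)))

sumP-at : ∀ {k} (ps : List (Poly k)) e → sumP ps e ≡ sumℤ (L.map (λ p → p e) ps)
sumP-at []       e with isZeroExp e
... | true  = refl
... | false = refl
sumP-at (p ∷ ps) e = cong (p e ⊕_) (sumP-at ps e)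

tutte2-at-target : ∀ {n} (M : BasisMatroid n) →
  tutte2 M target ≡ sumℤ (L.map (λ A₁ → sumℤ (L.map (τ M A₁) (allSubsets n))) (allSubsets n))
tutte2-at-target {n} M = begin
  tutte2 M target
    ≡⟨ sumP-at (concatMap summands (allSubsets n)) target ⟩
  sumℤ (L.map (λ p → p target) (concatMap summands (allSubsets n)))
    ≡⟨ sum-concatMap (λ p → p target) summands (allSubsets n) ⟩
  sumℤ (L.map (λ A₁ → sumℤ (L.map (λ p → p target) (summands A₁))) (allSubsets n))
    ≡⟨ cong sumℤ (LP.map-cong (λ A₁ → cong sumℤ (trans (sym (LP.map-∘ (allSubsets n)))
         (LP.map-cong (summand-at-target M A₁) (allSubsets n)))) (allSubsets n)) ⟩
  sumℤ (L.map (λ A₁ → sumℤ (L.map (τ M A₁) (allSubsets n))) (allSubsets n)) ∎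
  where
  open ≡-Reasoning
  summands : Subset n → List (Poly 8)
  summands A₁ = L.map (summand M A₁) (allSubsets n)

-- Cardinalities of finite subsets

⊆-large⇒≡ : ∀ {n} (p q : Subset n) → p ⊆ q → ∣ q ∣ ≤ ∣ p ∣ → p ≡ q
⊆-large⇒≡ []          []          _   _         = refl
⊆-large⇒≡ (false ∷ p) (false ∷ q) p⊆q q≤p       = cong (false ∷_) (⊆-large⇒≡ p q (SP.drop-∷-⊆ p⊆q) q≤p)
⊆-large⇒≡ (true ∷ p)  (true ∷ q)  p⊆q (s≤s q≤p) = cong (true ∷_) (⊆-large⇒≡ p q (SP.drop-∷-⊆ p⊆q) q≤p)
⊆-large⇒≡ (false ∷ p) (true ∷ q)  p⊆q q≤p       =
  ⊥-elim (NP.<-irrefl refl (NP.≤-trans q≤p (SP.p⊆q⇒∣p∣≤∣q∣ (SP.drop-∷-⊆ p⊆q))))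
⊆-large⇒≡ (true ∷ p)  (false ∷ q) p⊆q _ with p⊆q V.here
... | ()

∣p∪⁅i⁆∣ : ∀ {n} (p : Subset n) (i : Fin n) → i ∉ p → ∣ p ∪ ⁅ i ⁆ ∣ ≡ suc ∣ p ∣
∣p∪⁅i⁆∣ (false ∷ p) F.zero    i∉p = cong suc (cong ∣_∣ (SP.∪-identityʳ p))
∣p∪⁅i⁆∣ (true ∷ p)  F.zero    i∉p = ⊥-elim (i∉p V.here)
∣p∪⁅i⁆∣ (false ∷ p) (F.suc i) i∉p = ∣p∪⁅i⁆∣ p i (i∉p ∘ V.there)
∣p∪⁅i⁆∣ (true ∷ p)  (F.suc i) i∉p = cong suc (∣p∪⁅i⁆∣ p i (i∉p ∘ V.there))

∣p∪q∣+∣p∩q∣ : ∀ {n} (p q : Subset n) → ∣ p ∪ q ∣ + ∣ p ∩ q ∣ ≡ ∣ p ∣ + ∣ q ∣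
∣p∪q∣+∣p∩q∣ []          []          = refl
∣p∪q∣+∣p∩q∣ (false ∷ p) (false ∷ q) = ∣p∪q∣+∣p∩q∣ p q
∣p∪q∣+∣p∩q∣ (false ∷ p) (true ∷ q)  =
  trans (cong suc (∣p∪q∣+∣p∩q∣ p q)) (sym (NP.+-suc ∣ p ∣ ∣ q ∣))
∣p∪q∣+∣p∩q∣ (true ∷ p)  (false ∷ q) = cong suc (∣p∪q∣+∣p∩q∣ p q)
∣p∪q∣+∣p∩q∣ (true ∷ p)  (true ∷ q)  = cong suc (trans (NP.+-suc ∣ p ∪ q ∣ ∣ p ∩ q ∣)
  (trans (cong suc (∣p∪q∣+∣p∩q∣ p q)) (sym (NP.+-suc ∣ p ∣ ∣ q ∣))))

∣A∣≡∣C∣+∣A─C∣ : ∀ {n} (C A : Subset n) → C ⊆ A → ∣ A ∣ ≡ ∣ C ∣ + ∣ A ∩ ∁ C ∣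
∣A∣≡∣C∣+∣A─C∣ []          []          _   = refl
∣A∣≡∣C∣+∣A─C∣ (false ∷ C) (false ∷ A) C⊆A = ∣A∣≡∣C∣+∣A─C∣ C A (SP.drop-∷-⊆ C⊆A)
∣A∣≡∣C∣+∣A─C∣ (false ∷ C) (true ∷ A)  C⊆A =
  trans (cong suc (∣A∣≡∣C∣+∣A─C∣ C A (SP.drop-∷-⊆ C⊆A))) (sym (NP.+-suc _ _))
∣A∣≡∣C∣+∣A─C∣ (true ∷ C)  (true ∷ A)  C⊆A = cong suc (∣A∣≡∣C∣+∣A─C∣ C A (SP.drop-∷-⊆ C⊆A))
∣A∣≡∣C∣+∣A─C∣ (true ∷ C)  (false ∷ A) C⊆A with C⊆A V.here
... | ()

shrink : ∀ {n} (A : Subset n) k → k ≤ ∣ A ∣ → Σ (Subset n) λ C → C ⊆ A × ∣ C ∣ ≡ k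
shrink []          zero    _ = [] , id , refl
shrink (false ∷ A) k       k≤A with shrink A k k≤A
... | C , C⊆A , ∣C∣ = (false ∷ C) , SP.out⊆ C⊆A , ∣C∣
shrink {suc n} (true ∷ A) zero _ = S.⊥ , SP.⊥⊆ , SP.∣⊥∣≡0 (suc n)
shrink (true ∷ A)  (suc k) (s≤s k≤A) with shrink A k k≤A
... | C , C⊆A , ∣C∣ = (true ∷ C) , SP.s⊆s C⊆A , cong suc ∣C∣

enlarge : ∀ {n} (A : Subset n) k → ∣ A ∣ ≤ k → k ≤ n → Σ (Subset n) λ C → A ⊆ C × ∣ C ∣ ≡ k
enlarge []          zero    _         _         = [] , id , refl
enlarge (true ∷ A)  (suc k) (s≤s A≤k) (s≤s k≤n) with enlarge A k A≤k k≤n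
... | C , A⊆C , ∣C∣ = (true ∷ C) , SP.s⊆s A⊆C , cong suc ∣C∣
enlarge {suc n} (false ∷ A) k A≤k k≤1+n with k NP.≤? n
... | yes k≤n with enlarge A k A≤k k≤n
...   | C , A⊆C , ∣C∣ = (false ∷ C) , SP.s⊆s A⊆C , ∣C∣
enlarge {suc n} (false ∷ A) k A≤k k≤1+n | no k≰n =
  S.⊤ , SP.⊆⊤ , trans (SP.∣⊤∣≡n (suc n)) (NP.≤-antisym (NP.≰⇒> k≰n) k≤1+n)

element : ∀ {n} (D : Subset n) → 1 ≤ ∣ D ∣ → Σ (Fin n) (_∈ D)
element (true ∷ D)  _ = F.zero , V.here
element (false ∷ D) 1≤D with element D 1≤D
... | i , i∈D = F.suc i , V.there i∈D

two-elements : ∀ {n} (D : Subset n) → 2 ≤ ∣ D ∣ →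
  Σ (Fin n) λ i → Σ (Fin n) λ j → ¬ i ≡ j × i ∈ D × j ∈ D
two-elements (true ∷ D) (s≤s 1≤D) with element D 1≤D
... | j , j∈D = F.zero , F.suc j , (λ ()) , V.here , V.there j∈D
two-elements (false ∷ D) 2≤D with two-elements D 2≤D
... | i , j , i≢j , i∈D , j∈D = F.suc i , F.suc j , i≢j ∘ FP.suc-injective , V.there i∈D , V.there j∈D

∪⁅⁆-⊆ : ∀ {n} {C A : Subset n} {k} → C ⊆ A → k ∈ A → C ∪ ⁅ k ⁆ ⊆ A
∪⁅⁆-⊆ {C = C} {k = k} C⊆A k∈A x∈C∪k with SP.x∈p∪q⁻ C ⁅ k ⁆ x∈C∪k
... | inj₁ x∈C   = C⊆A x∈C
... | inj₂ x∈⁅k⁆ rewrite SP.x∈⁅y⁆⇒x≡y k x∈⁅k⁆ = k∈A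

-- Independent sets and rank of a matroid given by its bases

does⇒ : ∀ {P : Set} (P? : Dec P) → does P? ≡ true → P
does⇒ (yes p) _ = p

∧-≡true : ∀ {a b} → a ∧ b ≡ true → a ≡ true × b ≡ true
∧-≡true {true} {true} _ = refl , refl

allSubsets-complete : ∀ {n} (s : Subset n) → s ML.∈ allSubsets n
allSubsets-complete []      = here refl
allSubsets-complete (b ∷ s) =
  MLP.∈-concatMap⁺ (λ s → (outside ∷ s) ∷ (inside ∷ s) ∷ []) (Any.map (both b) (allSubsets-complete s))
  where
  both : ∀ b {s'} → s ≡ s' → (b ∷ s) ML.∈ ((outside ∷ s') ∷ (inside ∷ s') ∷ [])
  both false refl = here refl
  both true  refl = there (here refl)

anyL-intro : ∀ {A : Set} (f : A → Bool) (xs : List A) x → x ML.∈ xs → f x ≡ true → anyL f xs ≡ true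
anyL-intro f (y ∷ xs) x (here refl) fx rewrite fx = refl
anyL-intro f (y ∷ xs) x (there x∈xs) fx rewrite anyL-intro f xs x x∈xs fx = BP.∨-zeroʳ (f y)

anyL-elim : ∀ {A : Set} (f : A → Bool) (xs : List A) → anyL f xs ≡ true → Σ A λ x → f x ≡ true
anyL-elim f (y ∷ xs) any with f y in fy
... | true  = y , fy
... | false = anyL-elim f xs any

maxL-intro : ∀ {A : Set} (g : A → ℕ) (xs : List A) x → x ML.∈ xs → g x ≤ maxL (L.map g xs)
maxL-intro g (y ∷ xs) x (here refl)  = NP.m≤m⊔n (g x) _
maxL-intro g (y ∷ xs) x (there x∈xs) = NP.≤-trans (maxL-intro g xs x x∈xs) (NP.m≤n⊔m (g y) _)

maxL-bound : ∀ {A : Set} (g : A → ℕ) (xs : List A) k → (∀ x → g x ≤ k) → maxL (L.map g xs) ≤ k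
maxL-bound g []       k g≤k = z≤n
maxL-bound g (y ∷ xs) k g≤k = NP.⊔-lub (g≤k y) (maxL-bound g xs k g≤k)

module _ {n : ℕ} (M : BasisMatroid n) where

  independent-intro : ∀ I B → isBasis M B ≡ true → I ⊆ B → independent M I ≡ true
  independent-intro I B B-basis I⊆B = anyL-intro _ (allSubsets n) B (allSubsets-complete B)
    (trans (cong (_∧ (I ⊆ᵇ B)) B-basis) (Dec.dec-true (I SP.⊆? B) I⊆B))

  independent-elim : ∀ I → independent M I ≡ true → Σ (Subset n) λ B → isBasis M B ≡ true × I ⊆ B
  independent-elim I I-indep with anyL-elim _ (allSubsets n) I-indep
  ... | B , basis∧⊆ with ∧-≡true basis∧⊆
  ...   | B-basis , I⊆B = B , B-basis , does⇒ (I SP.⊆? B) I⊆B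

  rank-≥ : ∀ I A → independent M I ≡ true → I ⊆ A → ∣ I ∣ ≤ rank M A
  rank-≥ I A I-indep I⊆A = subst (_≤ rank M A) size-I
    (maxL-intro (λ I → if independent M I ∧ (I ⊆ᵇ A) then ∣ I ∣ else 0) (allSubsets n) I (allSubsets-complete I))
    where
    size-I : (if independent M I ∧ (I ⊆ᵇ A) then ∣ I ∣ else 0) ≡ ∣ I ∣
    size-I rewrite I-indep | Dec.dec-true (I SP.⊆? A) I⊆A = refl

  rank-≤ : ∀ A k → (∀ I → independent M I ≡ true → I ⊆ A → ∣ I ∣ ≤ k) → rank M A ≤ k
  rank-≤ A k bound = maxL-bound _ (allSubsets n) k size≤k
    where
    size≤k : ∀ I → (if independent M I ∧ (I ⊆ᵇ A) then ∣ I ∣ else 0) ≤ k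
    size≤k I with independent M I ∧ (I ⊆ᵇ A) in indep∧⊆
    ... | false = z≤n
    ... | true  = bound I (proj₁ (∧-≡true indep∧⊆)) (does⇒ (I SP.⊆? A) (proj₂ (∧-≡true indep∧⊆)))

-- The matroid whose bases are all r-sets except two sets X and Y

-- The value -2(m + 1) of the coefficient, as the sum of its four contributions;
-- it determines m.
twoExcludedValue : ℕ → ℤ
twoExcludedValue m = (-[1+ 0 ] ⊕ Z.- (+ m)) ⊕ (Z.- (+ m) ⊕ -[1+ 0 ])

∣twoExcludedValue∣ : ∀ m → Z.∣ twoExcludedValue m ∣ ≡ 2 + (m + m)
∣twoExcludedValue∣ zero    = refl
∣twoExcludedValue∣ (suc m) rewrite NP.+-identityʳ m | NP.+-suc m m = refl

double-injective : ∀ {a b} → a + a ≡ b + b → a ≡ b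
double-injective {a} {b} eq with NP.<-cmp a b
... | tri< a<b _ _ = ⊥-elim (NP.<⇒≢ (NP.+-mono-< a<b a<b) eq)
... | tri≈ _ a≡b _ = a≡b
... | tri> _ _ b<a = ⊥-elim (NP.<⇒≢ (NP.+-mono-< b<a b<a) (sym eq))

twoExcludedValue-injective : ∀ {m m'} → twoExcludedValue m ≡ twoExcludedValue m' → m ≡ m'
twoExcludedValue-injective {m} {m'} eq = double-injective (NP.+-cancelˡ-≡ 2 _ _
  (trans (sym (∣twoExcludedValue∣ m)) (trans (cong Z.∣_∣ eq) (∣twoExcludedValue∣ m'))))

-- Write r = q + 2.  X and Y are r-sets sharing at most r - 2 elements, in a
-- ground set of size at least r + 2.
module TwoExcluded (q n : ℕ) (X Y : Subset n) (∣X∣ : ∣ X ∣ ≡ suc (suc q)) (∣Y∣ : ∣ Y ∣ ≡ suc (suc q))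
                   (∣X∩Y∣≤q : ∣ X ∩ Y ∣ ≤ q) (r+2≤n : suc (suc (suc (suc q))) ≤ n) where

  r : ℕ
  r = suc (suc q)

  M : BasisMatroid n
  M = twoExcluded r n X Y

  Excluded : Subset n → Set
  Excluded B = B ≡ X ⊎ B ≡ Y

  excluded? : ∀ B → Dec (Excluded B)
  excluded? B = VP.≡-dec B._≟_ B X Dec.⊎-dec VP.≡-dec B._≟_ B Y

  ∣excluded∣ : ∀ {Z} → Excluded Z → ∣ Z ∣ ≡ r
  ∣excluded∣ (inj₁ refl) = ∣X∣
  ∣excluded∣ (inj₂ refl) = ∣Y∣

  r≤n : r ≤ n
  r≤n = NP.≤-trans (NP.n≤1+n r) (NP.≤-trans (NP.n≤1+n (suc r)) r+2≤n)

  basis-intro : ∀ B → ∣ B ∣ ≡ r → ¬ Excluded B → isBasis M B ≡ true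
  basis-intro B ∣B∣ B∉
    rewrite ∣B∣ | Dec.dec-false (VP.≡-dec B._≟_ B X) (B∉ ∘ inj₁)
              | Dec.dec-false (VP.≡-dec B._≟_ B Y) (B∉ ∘ inj₂)
    = cong (_∧ true) (Equivalence.to BP.T-≡ (NP.≡⇒≡ᵇ r r refl))

  basis-elim : ∀ B → isBasis M B ≡ true → ∣ B ∣ ≡ r × ¬ Excluded B
  basis-elim B B-basis with ∣ B ∣ N.≡ᵇ r in ∣B∣ | VP.≡-dec B._≟_ B X | VP.≡-dec B._≟_ B Y
  ... | true | no B≢X | no B≢Y =
    NP.≡ᵇ⇒≡ ∣ B ∣ r (Equivalence.from BP.T-≡ ∣B∣) , [ B≢X , B≢Y ]

  -- Exchange: if C has r - 1 elements and i ≠ j lie outside C, then C + i or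
  -- C + j is a basis, since C + i and C + j cannot be X and Y (C would lie in X ∩ Y).
  exchange : ∀ C i j → ∣ C ∣ ≡ suc q → ¬ i ≡ j → i ∉ C → j ∉ C →
    isBasis M (C ∪ ⁅ i ⁆) ≡ true ⊎ isBasis M (C ∪ ⁅ j ⁆) ≡ true
  exchange C i j ∣C∣ i≢j i∉C j∉C with excluded? (C ∪ ⁅ i ⁆) | excluded? (C ∪ ⁅ j ⁆)
  ... | no  Ci∉ | _       = inj₁ (basis-intro _ (trans (∣p∪⁅i⁆∣ C i i∉C) (cong suc ∣C∣)) Ci∉)
  ... | yes _   | no  Cj∉ = inj₂ (basis-intro _ (trans (∣p∪⁅i⁆∣ C j j∉C) (cong suc ∣C∣)) Cj∉)
  ... | yes Ci∈ | yes Cj∈ = ⊥-elim (both Ci∈ Cj∈)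
    where
    Ci≢Cj : ¬ C ∪ ⁅ i ⁆ ≡ C ∪ ⁅ j ⁆
    Ci≢Cj eq with SP.x∈p∪q⁻ C ⁅ j ⁆ (subst (i ∈_) eq (SP.q⊆p∪q C ⁅ i ⁆ (SP.x∈⁅x⁆ i)))
    ... | inj₁ i∈C  = i∉C i∈C
    ... | inj₂ i∈⁅j⁆ = i≢j (SP.x∈⁅y⁆⇒x≡y j i∈⁅j⁆)
    ⊆via : ∀ {Z} k → C ∪ ⁅ k ⁆ ≡ Z → C ⊆ Z
    ⊆via {Z} k eq {x} x∈C = subst (x ∈_) eq (SP.p⊆p∪q ⁅ k ⁆ x∈C)
    not-in-X∩Y : C ⊆ X → C ⊆ Y → ⊥
    not-in-X∩Y C⊆X C⊆Y = NP.<-irrefl refl (NP.≤-trans (NP.≤-reflexive (sym ∣C∣))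
      (NP.≤-trans (SP.p⊆q⇒∣p∣≤∣q∣ (λ x∈C → SP.x∈p∩q⁺ (C⊆X x∈C , C⊆Y x∈C))) ∣X∩Y∣≤q))
    both : Excluded (C ∪ ⁅ i ⁆) → Excluded (C ∪ ⁅ j ⁆) → ⊥
    both (inj₁ Ci≡X) (inj₁ Cj≡X) = Ci≢Cj (trans Ci≡X (sym Cj≡X))
    both (inj₂ Ci≡Y) (inj₂ Cj≡Y) = Ci≢Cj (trans Ci≡Y (sym Cj≡Y))
    both (inj₁ Ci≡X) (inj₂ Cj≡Y) = not-in-X∩Y (⊆via i Ci≡X) (⊆via j Cj≡Y)
    both (inj₂ Ci≡Y) (inj₁ Cj≡X) = not-in-X∩Y (⊆via j Cj≡X) (⊆via i Ci≡Y)

  extend-to-basis : ∀ C D → ∣ C ∣ ≡ suc q → 2 ≤ ∣ D ∩ ∁ C ∣ →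
    Σ (Fin n) λ k → k ∈ D × isBasis M (C ∪ ⁅ k ⁆) ≡ true
  extend-to-basis C D ∣C∣ 2≤D─C with two-elements (D ∩ ∁ C) 2≤D─C
  ... | i , j , i≢j , i∈D─C , j∈D─C
    with SP.x∈p∩q⁻ D (∁ C) i∈D─C | SP.x∈p∩q⁻ D (∁ C) j∈D─C
  ... | i∈D , i∈∁C | j∈D , j∈∁C
    with exchange C i j ∣C∣ i≢j (SP.x∈∁p⇒x∉p i∈∁C) (SP.x∈∁p⇒x∉p j∈∁C)
  ... | inj₁ Ci-basis = i , i∈D , Ci-basis
  ... | inj₂ Cj-basis = j , j∈D , Cj-basis

  -- Sets of size below r are independent (extend to an (r-1)-set, then to a basis).
  small-independent : ∀ A → ∣ A ∣ < r → independent M A ≡ true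
  small-independent A (s≤s ∣A∣≤r-1) with enlarge A (suc q) ∣A∣≤r-1 (NP.≤-trans (NP.n≤1+n (suc q)) r≤n)
  ... | C , A⊆C , ∣C∣ with extend-to-basis C S.⊤ ∣C∣ 2≤∁C
    where
    2≤∁C : 2 ≤ ∣ S.⊤ ∩ ∁ C ∣
    2≤∁C rewrite SP.∩-identityˡ (∁ C) | SP.∣∁p∣≡n∸∣p∣ C | ∣C∣ =
      NP.m+n≤o⇒m≤o∸n 2 (NP.≤-trans (NP.n≤1+n _) r+2≤n)
  ... | k , _ , Ck-basis = independent-intro M A (C ∪ ⁅ k ⁆) Ck-basis (SP.p⊆p∪q ⁅ k ⁆ ∘ A⊆C)

  independent-≤r : ∀ I → independent M I ≡ true → ∣ I ∣ ≤ r
  independent-≤r I I-indep with independent-elim M I I-indep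
  ... | B , B-basis , I⊆B =
    NP.≤-trans (SP.p⊆q⇒∣p∣≤∣q∣ I⊆B) (NP.≤-reflexive (proj₁ (basis-elim B B-basis)))

  basis-⊆⇒r≤rank : ∀ B A → isBasis M B ≡ true → B ⊆ A → r ≤ rank M A
  basis-⊆⇒r≤rank B A B-basis B⊆A = subst (_≤ rank M A) (proj₁ (basis-elim B B-basis))
    (rank-≥ M B A (independent-intro M B B B-basis id) B⊆A)

  rank-generic : ∀ A → ¬ Excluded A → rank M A ≡ ∣ A ∣ ⊓ r
  rank-generic A A∉ = NP.≤-antisym
    (rank-≤ M A (∣ A ∣ ⊓ r) λ I I-indep I⊆A →
      NP.⊓-glb (SP.p⊆q⇒∣p∣≤∣q∣ I⊆A) (independent-≤r I I-indep))
    lower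
    where
    lower : ∣ A ∣ ⊓ r ≤ rank M A
    lower with NP.<-cmp ∣ A ∣ r
    ... | tri< ∣A∣<r _ _ = NP.≤-trans (NP.m⊓n≤m _ r) (rank-≥ M A A (small-independent A ∣A∣<r) id)
    ... | tri≈ _ ∣A∣≡r _ = NP.≤-trans (NP.m⊓n≤n _ r) (basis-⊆⇒r≤rank A A (basis-intro A ∣A∣≡r A∉) id)
    ... | tri> _ _ r<∣A∣ with shrink A (suc q) (NP.≤-trans (NP.n≤1+n (suc q)) (NP.<⇒≤ r<∣A∣))
    ...   | C , C⊆A , ∣C∣ with extend-to-basis C A ∣C∣ 2≤A─C
      where
      2≤A─C : 2 ≤ ∣ A ∩ ∁ C ∣
      2≤A─C = NP.+-cancelˡ-≤ (suc q) 2 _ (subst (suc q + 2 ≤_)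
        (trans (∣A∣≡∣C∣+∣A─C∣ C A C⊆A) (cong (_+ ∣ A ∩ ∁ C ∣) ∣C∣))
        (subst (_≤ ∣ A ∣) (NP.+-comm 2 (suc q)) r<∣A∣))
    ...   | k , k∈A , Ck-basis = NP.≤-trans (NP.m⊓n≤n _ r)
      (basis-⊆⇒r≤rank (C ∪ ⁅ k ⁆) A Ck-basis (∪⁅⁆-⊆ C⊆A k∈A))

  -- X and Y themselves have rank r - 1: an independent r-subset of them would be
  -- a basis equal to them.
  rank-excluded : ∀ Z → Excluded Z → rank M Z ≡ suc q
  rank-excluded Z Z∈ = NP.≤-antisym (rank-≤ M Z (suc q) upper) lower
    where
    upper : ∀ I → independent M I ≡ true → I ⊆ Z → ∣ I ∣ ≤ suc q
    upper I I-indep I⊆Z with independent-elim M I I-indep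
    ... | B , B-basis , I⊆B with basis-elim B B-basis
    ...   | ∣B∣ , B∉ = NP.≤-pred (NP.≤∧≢⇒< (independent-≤r I I-indep) ∣I∣≢r)
      where
      ∣I∣≢r : ¬ ∣ I ∣ ≡ r
      ∣I∣≢r ∣I∣≡r = B∉ (subst Excluded (trans (sym I≡Z) I≡B) Z∈)
        where
        I≡Z = ⊆-large⇒≡ I Z I⊆Z (NP.≤-reflexive (trans (∣excluded∣ Z∈) (sym ∣I∣≡r)))
        I≡B = ⊆-large⇒≡ I B I⊆B (NP.≤-reflexive (trans ∣B∣ (sym ∣I∣≡r)))
    lower : suc q ≤ rank M Z
    lower with shrink Z (suc q) (subst (suc q ≤_) (sym (∣excluded∣ Z∈)) (NP.n≤1+n (suc q)))
    ... | C , C⊆Z , ∣C∣ =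
      subst (_≤ rank M Z) ∣C∣ (rank-≥ M C Z (small-independent C (NP.≤-reflexive (cong suc ∣C∣))) C⊆Z)

  rankM≡r : rankM M ≡ r
  rankM≡r = trans (rank-generic S.⊤ ⊤∉) (trans (cong (_⊓ r) (SP.∣⊤∣≡n n)) (NP.m≥n⇒m⊓n≡n r≤n))
    where
    ⊤∉ : ¬ Excluded S.⊤
    ⊤∉ ⊤∈ = NP.<-irrefl refl (NP.≤-trans (NP.≤-trans (NP.n≤1+n (suc r)) r+2≤n)
      (NP.≤-reflexive (trans (sym (SP.∣⊤∣≡n n)) (∣excluded∣ ⊤∈))))

  -- Only X and Y have both positive corank and positive nullity, so every other
  -- set contributes nothing to the coefficient at x₁y₁ (and at x₂y₂).
  at-xy-generic : ∀ A → ¬ Excluded A → at-xy M A ≡ + 0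
  at-xy-generic A A∉ rewrite rankM≡r | rank-generic A A∉ with NP.≤-total ∣ A ∣ r
  ... | inj₁ ∣A∣≤r rewrite NP.m≤n⇒m⊓n≡m ∣A∣≤r | NP.n∸n≡0 ∣ A ∣ = ZP.*-zeroʳ (c₁ (r ∸ ∣ A ∣))
  ... | inj₂ r≤∣A∣ rewrite NP.m≥n⇒m⊓n≡n r≤∣A∣ | NP.n∸n≡0 r = refl

  τ-generic₁ : ∀ A₁ A₂ → ¬ Excluded A₁ → τ M A₁ A₂ ≡ + 0
  τ-generic₁ A₁ A₂ A₁∉ rewrite at-xy-generic A₁ A₁∉ = refl

  τ-generic₂ : ∀ A₁ A₂ → ¬ Excluded A₂ → τ M A₁ A₂ ≡ + 0
  τ-generic₂ A₁ A₂ A₂∉ = trans (τ-sym M A₁ A₂) (τ-generic₁ A₂ A₁ A₂∉)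

  corank-excluded : ∀ Z → Excluded Z → corank M Z ≡ 1
  corank-excluded Z Z∈ rewrite rankM≡r | rank-excluded Z Z∈ = NP.m+n∸n≡m 1 (suc q)

  nullity-excluded : ∀ Z → Excluded Z → nullity M Z ≡ 1
  nullity-excluded Z Z∈ rewrite ∣excluded∣ Z∈ | rank-excluded Z Z∈ = NP.m+n∸n≡m 1 (suc q)

  at-xy-excluded : ∀ Z → Excluded Z → at-xy M Z ≡ + 1
  at-xy-excluded Z Z∈ rewrite corank-excluded Z Z∈ | nullity-excluded Z Z∈ = refl

  τ-diagonal : ∀ Z → Excluded Z → τ M Z Z ≡ -[1+ 0 ]
  τ-diagonal Z Z∈ rewrite SP.∩-idem Z | SP.∪-idem Z | corank-excluded Z Z∈ | nullity-excluded Z Z∈ = refl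

  -- With k = |X ∩ Y| and m = r - k: X ∩ Y is independent of corank m and X ∪ Y
  -- is spanning of nullity m, so the pair (X, Y) contributes (-1)^m · m(-1)^(m-1) = -m.
  k m : ℕ
  k = ∣ X ∩ Y ∣
  m = r ∸ k

  k<r : k < r
  k<r = NP.≤-trans (s≤s ∣X∩Y∣≤q) (NP.n≤1+n (suc q))

  ∣X∪Y∣≡r+m : ∣ X ∪ Y ∣ ≡ r + m
  ∣X∪Y∣≡r+m = NP.+-cancelʳ-≡ k _ _ (begin
    ∣ X ∪ Y ∣ + k   ≡⟨ ∣p∪q∣+∣p∩q∣ X Y ⟩
    ∣ X ∣ + ∣ Y ∣   ≡⟨ cong₂ _+_ ∣X∣ ∣Y∣ ⟩
    r + r           ≡⟨ cong (λ t → r + t) (sym (NP.m∸n+n≡m (NP.<⇒≤ k<r))) ⟩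
    r + (m + k)     ≡⟨ sym (NP.+-assoc r m k) ⟩
    r + m + k       ∎)
    where open ≡-Reasoning

  X∩Y∉ : ¬ Excluded (X ∩ Y)
  X∩Y∉ X∩Y∈ = NP.<⇒≢ k<r (∣excluded∣ X∩Y∈)

  X∪Y∉ : ¬ Excluded (X ∪ Y)
  X∪Y∉ X∪Y∈ = NP.<⇒≢ (NP.m<m+n r (NP.m<n⇒0<n∸m k<r))
                     (sym (trans (sym ∣X∪Y∣≡r+m) (∣excluded∣ X∪Y∈)))

  rank-X∩Y : rank M (X ∩ Y) ≡ k
  rank-X∩Y = trans (rank-generic (X ∩ Y) X∩Y∉) (NP.m≤n⇒m⊓n≡m (NP.<⇒≤ k<r))

  rank-X∪Y : rank M (X ∪ Y) ≡ r
  rank-X∪Y = trans (rank-generic (X ∪ Y) X∪Y∉)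
                   (NP.m≥n⇒m⊓n≡n (subst (r ≤_) (sym ∣X∪Y∣≡r+m) (NP.m≤m+n r m)))

  at-1-X∩Y : at-1 M (X ∩ Y) ≡ c₀ m
  at-1-X∩Y = begin
    c₀ (corank M (X ∩ Y)) ⊛ c₀ (nullity M (X ∩ Y))  ≡⟨ cong₂ (λ a b → c₀ a ⊛ c₀ b) corank-X∩Y nullity-X∩Y ⟩
    c₀ m ⊛ + 1                                       ≡⟨ ZP.*-identityʳ (c₀ m) ⟩
    c₀ m                                             ∎
    where
    open ≡-Reasoning
    corank-X∩Y : corank M (X ∩ Y) ≡ m
    corank-X∩Y = cong₂ _∸_ rankM≡r rank-X∩Y
    nullity-X∩Y : nullity M (X ∩ Y) ≡ 0
    nullity-X∩Y = trans (cong (k ∸_) rank-X∩Y) (NP.n∸n≡0 k)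

  at-y-X∪Y : at-y M (X ∪ Y) ≡ c₁ m
  at-y-X∪Y = begin
    c₀ (corank M (X ∪ Y)) ⊛ c₁ (nullity M (X ∪ Y))  ≡⟨ cong₂ (λ a b → c₀ a ⊛ c₁ b) corank-X∪Y nullity-X∪Y ⟩
    + 1 ⊛ c₁ m                                       ≡⟨ ZP.*-identityˡ (c₁ m) ⟩
    c₁ m                                             ∎
    where
    open ≡-Reasoning
    corank-X∪Y : corank M (X ∪ Y) ≡ 0
    corank-X∪Y = trans (cong₂ _∸_ rankM≡r rank-X∪Y) (NP.n∸n≡0 r)
    nullity-X∪Y : nullity M (X ∪ Y) ≡ m
    nullity-X∪Y = trans (cong₂ _∸_ ∣X∪Y∣≡r+m rank-X∪Y) (NP.m+n∸m≡n r m)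

  τ-XY : τ M X Y ≡ Z.- (+ m)
  τ-XY = begin
    τ M X Y                  ≡⟨ ⊛-cong₄ (at-xy-excluded X (inj₁ refl)) (at-xy-excluded Y (inj₂ refl))
                                        at-1-X∩Y at-y-X∪Y ⟩
    + 1 ⊛ + 1 ⊛ c₀ m ⊛ c₁ m  ≡⟨ cong (_⊛ c₁ m) (ZP.*-identityˡ (c₀ m)) ⟩
    c₀ m ⊛ c₁ m              ≡⟨ c₀*c₁ m ⟩
    Z.- (+ m)                ∎
    where open ≡-Reasoning

  X≢Y : ¬ X ≡ Y
  X≢Y X≡Y = NP.<⇒≢ k<r (begin
    ∣ X ∩ Y ∣  ≡⟨ cong (λ Z → ∣ X ∩ Z ∣) (sym X≡Y) ⟩
    ∣ X ∩ X ∣  ≡⟨ cong ∣_∣ (SP.∩-idem X) ⟩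
    ∣ X ∣      ≡⟨ ∣X∣ ⟩
    r          ∎)
    where open ≡-Reasoning

  coefficient : tutte2 M target ≡ twoExcludedValue m
  coefficient = begin
    tutte2 M target
      ≡⟨ tutte2-at-target M ⟩
    sumℤ (L.map (λ A₁ → sumℤ (L.map (τ M A₁) subsets)) subsets)
      ≡⟨ sum-over-XY (λ A₁ → sumℤ (L.map (τ M A₁) subsets))
           (λ A₁ A₁∉ → sum-zero (τ M A₁) subsets λ A₂ → τ-generic₁ A₁ A₂ A₁∉) ⟩
    sumℤ (L.map (τ M X) subsets) ⊕ sumℤ (L.map (τ M Y) subsets)
      ≡⟨ cong₂ _⊕_ (sum-over-XY (τ M X) (τ-generic₂ X)) (sum-over-XY (τ M Y) (τ-generic₂ Y)) ⟩
    (τ M X X ⊕ τ M X Y) ⊕ (τ M Y X ⊕ τ M Y Y)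
      ≡⟨ cong₂ _⊕_ (cong₂ _⊕_ (τ-diagonal X (inj₁ refl)) τ-XY)
                   (cong₂ _⊕_ (trans (τ-sym M Y X) τ-XY) (τ-diagonal Y (inj₂ refl))) ⟩
    (-[1+ 0 ] ⊕ Z.- (+ m)) ⊕ (Z.- (+ m) ⊕ -[1+ 0 ]) ∎
    where
    open ≡-Reasoning
    subsets = allSubsets n
    sum-over-XY : ∀ (g : Subset n → ℤ) → (∀ A → ¬ Excluded A → g A ≡ + 0) →
      sumℤ (L.map g subsets) ≡ g X ⊕ g Y
    sum-over-XY g g≡0 = countsOnce-two (VP.≡-dec B._≟_) subsets (allSubsets-countsOnce n) g X Y X≢Y
      λ A A≢X A≢Y → g≡0 A [ A≢X , A≢Y ]

inRange : ℕ → ℕ → ℕ → Bool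
inRange a b i = (a ≤ᵇ i) ∧ (i <ᵇ b)

∈-interval⁻ : ∀ {n a b} (i : Fin n) → i ∈ interval n a b → a ≤ toℕ i × toℕ i < b
∈-interval⁻ {n} {a} {b} i i∈ with ∧-≡true {a ≤ᵇ toℕ i} {toℕ i <ᵇ b} (if-inside
  (trans (sym (VP.lookup∘tabulate (λ i → if inRange a b (toℕ i) then inside else outside) i)) (VP.[]=⇒lookup i∈)))
  where
  if-inside : ∀ {c} → (if c then inside else outside) ≡ inside → c ≡ true
  if-inside {true} _ = refl
... | a≤i , i<b = NP.≤ᵇ⇒≤ a (toℕ i) (Equivalence.from BP.T-≡ a≤i)
                , NP.<ᵇ⇒< (toℕ i) b (Equivalence.from BP.T-≡ i<b)

∈-interval⁺ : ∀ {n a b} (i : Fin n) → a ≤ toℕ i → toℕ i < b → i ∈ interval n a b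
∈-interval⁺ {n} {a} {b} i a≤i i<b = VP.lookup⇒[]= i _
  (trans (VP.lookup∘tabulate (λ i → if inRange a b (toℕ i) then inside else outside) i)
    (cong (λ c → if c then inside else outside)
      (cong₂ _∧_ (Equivalence.to BP.T-≡ (NP.≤⇒≤ᵇ a≤i)) (Equivalence.to BP.T-≡ (NP.<⇒<ᵇ i<b)))))

∣interval∣ : ∀ n a b → a ≤ b → b ≤ n → ∣ interval n a b ∣ ≡ b ∸ a
∣interval∣ zero    zero    zero    _         _         = refl
∣interval∣ (suc n) zero    zero    _         _         = empty n
  where
  empty : ∀ n → ∣ interval n 0 0 ∣ ≡ 0
  empty zero    = refl
  empty (suc n) = empty n
∣interval∣ (suc n) zero    (suc b) _         (s≤s b≤n) = cong suc (∣interval∣ n 0 b z≤n b≤n)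
∣interval∣ (suc n) (suc a) (suc b) (s≤s a≤b) (s≤s b≤n) =
  trans (cong (∣_∣ {n}) (VP.tabulate-cong {n = n} λ i →
           cong (λ c → if c then inside else outside) (shift a b (toℕ i))))
        (∣interval∣ n a b a≤b b≤n)
  where
  shift : ∀ a b i → inRange (suc a) (suc b) (suc i) ≡ inRange a b i
  shift zero    b i = refl
  shift (suc a) b i = refl

interval-∩ : ∀ n a b c d → interval n a b ∩ interval n c d ≡ interval n (a ⊔ c) (b ⊓ d)
interval-∩ n a b c d = SP.⊆-antisym
  (λ {i} i∈ → let (i∈ab , i∈cd) = SP.x∈p∩q⁻ (interval n a b) (interval n c d) i∈
                  (a≤i , i<b) = ∈-interval⁻ {n} {a} {b} i i∈ab
                  (c≤i , i<d) = ∈-interval⁻ {n} {c} {d} i i∈cd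
              in ∈-interval⁺ i (NP.⊔-lub a≤i c≤i) (NP.⊓-glb i<b i<d))
  (λ {i} i∈ → let (a⊔c≤i , i<b⊓d) = ∈-interval⁻ {n} {a ⊔ c} {b ⊓ d} i i∈ in SP.x∈p∩q⁺
    ( ∈-interval⁺ i (NP.m⊔n≤o⇒m≤o a c a⊔c≤i) (NP.m<n⊓o⇒m<n b d i<b⊓d)
    , ∈-interval⁺ i (NP.m⊔n≤o⇒n≤o a c a⊔c≤i) (NP.m<n⊓o⇒m<o b d i<b⊓d)))

module _ (q n : ℕ) where
  -- r = q + 2, so that r - 1 = q + 1 and 2r - 1 = (q + 1) + r
  private
    r : ℕ
    r = suc (suc q)

  ∣X₁∣ : r ≤ n → ∣ X₁ r n ∣ ≡ r
  ∣X₁∣ r≤n = ∣interval∣ n 0 r z≤n r≤n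

  ∣X₂∣ : r + r ≤ n → ∣ X₂ r n ∣ ≡ r
  ∣X₂∣ 2r≤n = trans (∣interval∣ n r (r + r) (NP.m≤m+n r r) 2r≤n) (NP.m+n∸m≡n r r)

  ∣X₃∣ : r + r ≤ n → ∣ X₃ r n ∣ ≡ r
  ∣X₃∣ 2r≤n = trans (∣interval∣ n (suc q) (suc q + r) (NP.m≤m+n (suc q) r)
                       (NP.≤-trans (NP.+-monoˡ-≤ r (NP.n≤1+n (suc q))) 2r≤n))
                    (NP.m+n∸m≡n (suc q) r)

  ∣X₁∩X₂∣ : r ≤ n → ∣ X₁ r n ∩ X₂ r n ∣ ≡ 0
  ∣X₁∩X₂∣ r≤n = begin
    ∣ X₁ r n ∩ X₂ r n ∣             ≡⟨ cong ∣_∣ (interval-∩ n 0 r r (r + r)) ⟩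
    ∣ interval n r (r ⊓ (r + r)) ∣  ≡⟨ cong (λ b → ∣ interval n r b ∣) (NP.m≤n⇒m⊓n≡m (NP.m≤m+n r r)) ⟩
    ∣ interval n r r ∣              ≡⟨ ∣interval∣ n r r NP.≤-refl r≤n ⟩
    r ∸ r                           ≡⟨ NP.n∸n≡0 r ⟩
    0                               ∎
    where open ≡-Reasoning

  ∣X₁∩X₃∣ : r ≤ n → ∣ X₁ r n ∩ X₃ r n ∣ ≡ 1
  ∣X₁∩X₃∣ r≤n = begin
    ∣ X₁ r n ∩ X₃ r n ∣
      ≡⟨ cong ∣_∣ (interval-∩ n 0 r (suc q) (suc q + r)) ⟩
    ∣ interval n (suc q) (r ⊓ (suc q + r)) ∣
      ≡⟨ cong (λ b → ∣ interval n (suc q) b ∣) (NP.m≤n⇒m⊓n≡m (NP.m≤n+m r (suc q))) ⟩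
    ∣ interval n (suc q) r ∣
      ≡⟨ ∣interval∣ n (suc q) r (NP.n≤1+n (suc q)) r≤n ⟩
    r ∸ suc q
      ≡⟨ NP.m+n∸n≡m 1 (suc q) ⟩
    1 ∎
    where open ≡-Reasoning

mainTheorem2 : (r n : ℕ) → 3 ≤ r → r + r ≤ n →
    ¬ (tutte2 R[ r , n ] ≈ₚ tutte2 Q[ r , n ])
mainTheorem2 (suc (suc (suc p))) n (s≤s (s≤s (s≤s _))) 2r≤n R≈Q =
  NP.1+n≢n (twoExcludedValue-injective {r} {suc q} (begin
    twoExcludedValue (r ∸ 0)  ≡⟨ cong (λ k → twoExcludedValue (r ∸ k)) (sym (∣X₁∩X₂∣ q n r≤n)) ⟩
    twoExcludedValue R.m      ≡⟨ sym R.coefficient ⟩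
    tutte2 R[ r , n ] target  ≡⟨ R≈Q target ⟩
    tutte2 Q[ r , n ] target  ≡⟨ Q.coefficient ⟩
    twoExcludedValue Q.m      ≡⟨ cong (λ k → twoExcludedValue (r ∸ k)) (∣X₁∩X₃∣ q n r≤n) ⟩
    twoExcludedValue (r ∸ 1)  ∎))
  where
  open ≡-Reasoning
  q r : ℕ
  q = suc p
  r = suc (suc q)
  r≤n : r ≤ n
  r≤n = NP.≤-trans (NP.m≤m+n r r) 2r≤n
  r+2≤n : suc (suc r) ≤ n
  r+2≤n = NP.≤-trans (NP.+-monoˡ-≤ r {2} {r} (s≤s (s≤s z≤n))) 2r≤n
  module R = TwoExcluded q n (X₁ r n) (X₂ r n) (∣X₁∣ q n r≤n) (∣X₂∣ q n 2r≤n)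
               (subst (_≤ q) (sym (∣X₁∩X₂∣ q n r≤n)) z≤n) r+2≤n
  module Q = TwoExcluded q n (X₁ r n) (X₃ r n) (∣X₁∣ q n r≤n) (∣X₃∣ q n 2r≤n)
               (subst (_≤ q) (sym (∣X₁∩X₃∣ q n r≤n)) (s≤s z≤n)) r+2≤n
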